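{- Let $q \ge 2$ be an integer and let $a_2, \dots, a_q$ be integers with $a_i \ge 1$ for $2 \le i \le q$ and $a_q \ge 2$. Let $r$ be a positive integer, and put $k = 1 + rq$, $c = 2 + (r-1)q$. Let $\{G_n\}_{n \ge 1}$ be defined by $G_1 = 1$, $G_i = 0$ for $2 \le i \le k$, and for $n > k$ $$G_n = G_{n-k} - \left(a_2 G_{n-k+1} + \cdots + a_q G_{n-k+q-1}\right) - \left(G_{n-k+q} + \cdots + G_{n-1}\right).$$ This is the recursion whose characteristic polynomial, with leading coefficient $-1$, is the degree-$k$ Taylor polynomial of $2 - \frac{1}{1-X} - \sum_{i=2}^q (a_i-1)X^{i-1}$. Set $R_{t,s} = G_{k+(t-1)c+s}$ for $1 \le t \le r$, $1 \le s \le c$, and $l(t) = 2 + (t-1)q$. Then for $1 \le t \le r$, $$R_{t,1} = \bigl(-(a_q - 1)\bigr)^{t-1}, \qquad R_{t,l(t)} = (-1)^t.$$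
   Context: $R_{t,s}$ is the $r\times c$ rectangle formed by writing $G_{k+1},\dots,G_{k+rc}$ row by row, with $c$ entries per row. -}

module Defs where

open import Data.Nat using (ℕ; zero; suc; _+_; _*_; _∸_; _≤_; _<_)
open import Data.Integer using (ℤ; +_; _-_; -_; _^_) renaming (_*_ to _*ℤ_; _+_ to _+ℤ_; _≤_ to _≤ℤ_)
open import Relation.Binary.PropositionalEquality using (_≡_)

sumFrom : ℕ → ℕ → (ℕ → ℤ) → ℤ
sumFrom lo zero    f = + 0
sumFrom lo (suc n) f = f lo +ℤ sumFrom (suc lo) n f

-- Σ_{j=lo}^{hi} f j  (empty, i.e. 0, when hi < lo)
sumIcc : ℕ → ℕ → (ℕ → ℤ) → ℤ
sumIcc lo hi f = sumFrom lo (suc hi ∸ lo) f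

kOf : ℕ → ℕ → ℕ
kOf q r = 1 + r * q

cOf : ℕ → ℕ → ℕ
cOf q r = 2 + (r ∸ 1) * q

lOf : ℕ → ℕ → ℕ
lOf q t = 2 + (t ∸ 1) * q

-- G : ℕ → ℤ (only indices n ≥ 1 are meaningful) is the sequence of the paper:
-- G_1 = 1, G_i = 0 for 2 ≤ i ≤ k, and for n > k
-- G_n = G_{n-k} - (a_2 G_{n-k+1} + ... + a_q G_{n-k+q-1}) - (G_{n-k+q} + ... + G_{n-1}).
record IsGSeq (q r : ℕ) (a : ℕ → ℤ) (G : ℕ → ℤ) : Set where
  field
    init₁   : G 1 ≡ + 1
    init₀   : ∀ i → 2 ≤ i → i ≤ kOf q r → G i ≡ + 0
    recur   : ∀ n → kOf q r < n →
              G n ≡ (G (n ∸ kOf q r)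
                      - sumIcc 2 q (λ i → a i *ℤ G (n ∸ kOf q r + i ∸ 1)))
                      - sumIcc (n ∸ kOf q r + q) (n ∸ 1) G

-- Write P n = G 1 + ⋯ + G n. At n = m + k the recursion becomes
--   P (m + k) = P (m + q - 1) + G m - (a₂ G (m + 1) + ⋯ + a_q G (m + q - 1)),
-- so if P is constant on [m - 1, m + q - 1], it takes the same value at m + k.
-- Since P = 1 on [1, k], induction on t gives P = 1 on [S t, S t + (r - t) q] with S t = 1 + t (k + 1),
-- and the passage from one plateau to the next forces G (S t) = (-1)^t. The entry just after the
-- end of plateau t sees P = 1 plus the previous first-column value g and, in the weighted sum, only
-- a_q g, which produces the factor -(a_q - 1).
module Submission where

open import Defs
open import Data.Nat using (ℕ; zero; suc; _+_; _*_; _∸_; _≤_; _<_; z≤n; s≤s)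
open import Data.Integer using (ℤ; +_; _-_; -_; _^_) renaming (_≤_ to _≤ℤ_; _+_ to _+ℤ_; _*_ to _*ℤ_)
open import Relation.Binary.PropositionalEquality
  using (_≡_; refl; sym; trans; cong; cong₂; subst; module ≡-Reasoning)
open import Data.Product using (_×_; _,_; proj₁; proj₂)
open import Data.Nat.Properties
  using (≤-refl; ≤-trans; ≤-reflexive; n≤1+n; m≤n+m; m≤n⇒m≤o+n; m≤n⇒m≤n+o; +-monoʳ-≤; +-monoˡ-≤;
         +-identityʳ; +-suc; +-assoc; +-comm; m+n∸n≡m; m∸n+n≡m; m≤n⇒∃[o]m+o≡n)
open import Data.Integer.Properties using (i≡j⇒i-j≡0)
import Data.Integer.Properties as ℤ
open import Data.List using (_∷_; [])
open import Data.Nat.Tactic.RingSolver using (solve)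
import Data.Integer.Tactic.RingSolver as ℤ-Solver

sumFrom-zero : ∀ lo n (f : ℕ → ℤ) → (∀ j → j < n → f (lo + j) ≡ + 0) → sumFrom lo n f ≡ + 0
sumFrom-zero lo zero    f f≡0 = refl
sumFrom-zero lo (suc n) f f≡0 = cong₂ _+ℤ_ head tail
  where
  head : f lo ≡ + 0
  head = trans (cong f (sym (+-identityʳ lo))) (f≡0 0 (s≤s z≤n))
  tail : sumFrom (suc lo) n f ≡ + 0
  tail = sumFrom-zero (suc lo) n f λ j j<n → trans (cong f (sym (+-suc lo j))) (f≡0 (suc j) (s≤s j<n))

sumFrom-snoc : ∀ lo n (f : ℕ → ℤ) → sumFrom lo (suc n) f ≡ sumFrom lo n f +ℤ f (lo + n)
sumFrom-snoc lo zero    f = trans (ℤ.+-comm (f lo) (+ 0)) (cong (λ i → + 0 +ℤ f i) (sym (+-identityʳ lo)))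
sumFrom-snoc lo (suc n) f = begin
  f lo +ℤ sumFrom (suc lo) (suc n) f               ≡⟨ cong (f lo +ℤ_) (sumFrom-snoc (suc lo) n f) ⟩
  f lo +ℤ (sumFrom (suc lo) n f +ℤ f (suc lo + n)) ≡⟨ sym (ℤ.+-assoc (f lo) _ _) ⟩
  sumFrom lo (suc n) f +ℤ f (suc lo + n)           ≡⟨ cong (λ i → sumFrom lo (suc n) f +ℤ f i) (sym (+-suc lo n)) ⟩
  sumFrom lo (suc n) f +ℤ f (lo + suc n)           ∎
  where open ≡-Reasoning

+-minus-cancelˡ : ∀ (x y : ℤ) → (x +ℤ y) - x ≡ y
+-minus-cancelˡ = ℤ-Solver.solve-∀

minus-telescope : ∀ (x y z : ℤ) → (y - x) +ℤ (z - y) ≡ z - x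
minus-telescope = ℤ-Solver.solve-∀

module PrefixSums (G : ℕ → ℤ) where

  P : ℕ → ℤ
  P zero    = + 0
  P (suc n) = P n +ℤ G (suc n)

  G≡ΔP : ∀ n → G (suc n) ≡ P (suc n) - P n
  G≡ΔP n = sym (+-minus-cancelˡ (P n) (G (suc n)))

  sumFrom≡ΔP : ∀ x n → sumFrom (suc x) n G ≡ P (n + x) - P x
  sumFrom≡ΔP x zero    = sym (i≡j⇒i-j≡0 {P x} refl)
  sumFrom≡ΔP x (suc n) = begin
    G (suc x) +ℤ sumFrom (suc (suc x)) n G   ≡⟨ cong₂ _+ℤ_ (G≡ΔP x) (sumFrom≡ΔP (suc x) n) ⟩
    (P (suc x) - P x) +ℤ (P (n + suc x) - P (suc x))
      ≡⟨ minus-telescope (P x) (P (suc x)) (P (n + suc x)) ⟩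
    P (n + suc x) - P x                      ≡⟨ cong (λ i → P i - P x) (+-suc n x) ⟩
    P (suc n + x) - P x                      ∎
    where open ≡-Reasoning

  sumIcc≡ΔP : ∀ lo hi → lo ≤ hi → sumIcc (suc lo) hi G ≡ P hi - P lo
  sumIcc≡ΔP lo hi lo≤hi = trans (sumFrom≡ΔP lo (hi ∸ lo)) (cong (λ i → P i - P lo) (m∸n+n≡m lo≤hi))

  ConstantOn : ℤ → ℕ → ℕ → Set
  ConstantOn v lo n = ∀ y → y ≤ n → P (y + lo) ≡ v

  ConstantOn-⊆ : ∀ {v lo m n} → m ≤ n → ConstantOn v lo n → ConstantOn v lo m
  ConstantOn-⊆ m≤n const y y≤m = const y (≤-trans y≤m m≤n)

  ConstantOn-shift : ∀ {v lo n} d m → m + d ≤ n → ConstantOn v lo n → ConstantOn v (d + lo) m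
  ConstantOn-shift {lo = lo} d m m+d≤n const y y≤m =
    trans (cong P (sym (+-assoc y d lo))) (const (y + d) (≤-trans (+-monoˡ-≤ d y≤m) m+d≤n))

  ConstantOn⇒G≡0 : ∀ {v lo n} → ConstantOn v lo n → ∀ y → y < n → G (suc (y + lo)) ≡ + 0
  ConstantOn⇒G≡0 const y (s≤s y<n) =
    trans (G≡ΔP (y + _)) (i≡j⇒i-j≡0 (trans (const (suc y) (s≤s y<n)) (sym (const y (≤-trans y<n (n≤1+n _))))))

module Rectangle (p r′ : ℕ) (a G : ℕ → ℤ) (isG : IsGSeq (2 + p) (suc r′) a G) where
  open IsGSeq isG
  open PrefixSums G

  q r k : ℕ
  q = 2 + p
  r = suc r′
  k = kOf q r

  -- window (q ∸ 1) x is the sum a₂ G (m + 1) + ⋯ + a_q G (m + q ∸ 1) of the recursion at m = suc x.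
  window : ℕ → ℕ → ℤ
  window n x = sumFrom 2 n (λ i → a i *ℤ G (suc x + i ∸ 1))

  window-zero : ∀ {v} n x → ConstantOn v (suc x) n → window n x ≡ + 0
  window-zero n x const = sumFrom-zero 2 n _ λ j j<n →
    trans (cong (λ i → a (2 + j) *ℤ G i) (index j)) (trans (cong (a (2 + j) *ℤ_) (ConstantOn⇒G≡0 const j j<n)) (ℤ.*-zeroʳ (a (2 + j))))
    where
    index : ∀ j → x + suc (suc j) ≡ suc (j + suc x)
    index j = solve (x ∷ j ∷ [])

  P-recur : ∀ x → P (suc x + k) ≡ (P (suc p + suc x) +ℤ G (suc x)) - window (suc p) x
  P-recur x = begin
    P (x + k) +ℤ G (suc x + k)                                        ≡⟨ cong (P (x + k) +ℤ_) G-recur ⟩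
    P (x + k) +ℤ ((G (suc x) - window (suc p) x) - sumIcc (suc x + q) (x + k) G)
      ≡⟨ cong (λ s → P (x + k) +ℤ ((G (suc x) - window (suc p) x) - s)) (sumIcc≡ΔP (x + q) (x + k) (+-monoʳ-≤ x q≤k)) ⟩
    P (x + k) +ℤ ((G (suc x) - window (suc p) x) - (P (x + k) - P (x + q)))
      ≡⟨ algebra (P (x + k)) (P (x + q)) (G (suc x)) (window (suc p) x) ⟩
    (P (x + q) +ℤ G (suc x)) - window (suc p) x                       ≡⟨ cong (λ i → (P i +ℤ G (suc x)) - window (suc p) x) tail-start ⟩
    (P (suc p + suc x) +ℤ G (suc x)) - window (suc p) x               ∎
    where
    open ≡-Reasoning
    algebra : ∀ Pk Pq g w → Pk +ℤ ((g - w) - (Pk - Pq)) ≡ (Pq +ℤ g) - w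
    algebra = ℤ-Solver.solve-∀
    tail-start : x + q ≡ suc p + suc x
    tail-start = trans (+-comm x q) (sym (+-suc (suc p) x))
    q≤k : q ≤ k
    q≤k = ≤-trans (m≤n⇒m≤n+o (r′ * q) ≤-refl) (n≤1+n _)
    G-recur : G (suc x + k) ≡ (G (suc x) - window (suc p) x) - sumIcc (suc x + q) (x + k) G
    G-recur = subst (λ m → G (suc x + k) ≡ (G m - sumIcc 2 q (λ i → a i *ℤ G (m + i ∸ 1))) - sumIcc (m + q) (x + k) G)
                    (m+n∸n≡m (suc x) k) (recur (suc x + k) (s≤s (m≤n+m k x)))

  P-recur-constant : ∀ {v} x → ConstantOn v (suc x) (suc p) → P (suc x + k) ≡ v +ℤ G (suc x)
  P-recur-constant {v} x const = begin
    P (suc x + k)                                              ≡⟨ P-recur x ⟩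
    (P (suc p + suc x) +ℤ G (suc x)) - window (suc p) x        ≡⟨ cong₂ (λ P′ w → (P′ +ℤ G (suc x)) - w) (const (suc p) ≤-refl)
                                                                         (window-zero (suc p) x const) ⟩
    (v +ℤ G (suc x)) - + 0                                     ≡⟨ ℤ.+-identityʳ _ ⟩
    v +ℤ G (suc x)                                             ∎
    where open ≡-Reasoning

  -- For 1 ≤ t ≤ r, S t is the index of the diagonal entry R_{t, l t} of the paper.
  S : ℕ → ℕ
  S t = suc (t * suc k)

  S-suc : ∀ t y → y + S (suc t) ≡ suc (y + S t) + k
  S-suc t y = shift k
    where
    shift : ∀ κ → y + suc (suc t * suc κ) ≡ suc (y + suc (t * suc κ)) + κ
    shift κ = solve (y ∷ t ∷ κ ∷ [])

  -- Plateau t (r ∸ t) says P ≡ 1 from S t up to the index just before R_{t+1, 1}.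
  Plateau : ℕ → ℕ → Set
  Plateau t e = ConstantOn (+ 1) (S t) (e * q)

  plateau-initial : Plateau 0 r
  plateau-initial y y≤rq = trans (cong P (+-comm y 1)) (P-initial y y≤rq)
    where
    P-initial : ∀ y → y ≤ r * q → P (suc y) ≡ + 1
    P-initial zero    _    = cong (+ 0 +ℤ_) init₁
    P-initial (suc y) y<rq = cong₂ _+ℤ_ (P-initial y (≤-trans (n≤1+n y) y<rq))
                                         (init₀ (2 + y) (s≤s (s≤s z≤n)) (s≤s y<rq))

  plateau-step : ∀ t e → Plateau t (suc e) → Plateau (suc t) e
  plateau-step t e plateau y y≤eq = begin
    P (y + S (suc t))               ≡⟨ cong P (S-suc t y) ⟩
    P (suc (y + S t) + k)           ≡⟨ P-recur-constant (y + S t) (ConstantOn-shift (suc y) (suc p) window-in-plateau plateau) ⟩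
    + 1 +ℤ G (suc (y + S t))        ≡⟨ cong (+ 1 +ℤ_) (ConstantOn⇒G≡0 plateau y (s≤s (m≤n⇒m≤o+n (suc p) y≤eq))) ⟩
    + 1                             ∎
    where
    open ≡-Reasoning
    window-in-plateau : suc p + suc y ≤ suc e * q
    window-in-plateau = subst (_≤ q + e * q) (sym (+-suc (suc p) y)) (+-monoʳ-≤ q y≤eq)

  diagonal-step : ∀ t e → Plateau t (suc e) → G (S t) ≡ (- + 1) ^ t → G (S (suc t)) ≡ (- + 1) ^ suc t
  diagonal-step t e plateau diagonal = begin
    G (S (suc t))                                    ≡⟨ cong G (S-suc t 0) ⟩
    G (suc (S t + k))                                ≡⟨ G≡ΔP (S t + k) ⟩
    P (suc (S t + k)) - P (S t + k)                  ≡⟨ cong₂ _-_ (trans (cong P (sym (S-suc t 0))) (plateau-step t e plateau 0 z≤n))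
                                                                  (P-recur-constant (t * suc k) (ConstantOn-⊆ window-in-plateau plateau)) ⟩
    + 1 - (+ 1 +ℤ G (S t))                           ≡⟨ cong (λ g → + 1 - (+ 1 +ℤ g)) diagonal ⟩
    + 1 - (+ 1 +ℤ (- + 1) ^ t)                       ≡⟨ algebra ((- + 1) ^ t) ⟩
    (- + 1) ^ suc t                                  ∎
    where
    open ≡-Reasoning
    algebra : ∀ s → + 1 - (+ 1 +ℤ s) ≡ (- + 1) *ℤ s
    algebra = ℤ-Solver.solve-∀
    window-in-plateau : suc p ≤ suc e * q
    window-in-plateau = m≤n⇒m≤n+o (e * q) (n≤1+n (suc p))

  plateau-diagonal : ∀ t e → t + e ≡ r → Plateau t e × G (S t) ≡ (- + 1) ^ t
  plateau-diagonal zero    e refl  = plateau-initial , init₁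
  plateau-diagonal (suc t) e t+e≡r with plateau-diagonal t (suc e) (trans (+-suc t e) t+e≡r)
  ... | plateau , diagonal = plateau-step t e plateau , diagonal-step t e plateau diagonal

  -- Here the window of the recursion reaches exactly one index past the plateau, so of the
  -- weighted sum only the last term, a_q times the next first-column entry, survives.
  P-recur-past-plateau : ∀ u e → Plateau u (suc (suc e)) →
                         let g = G (suc (suc (suc e) * q + S u)) in
                         P (suc (suc (suc e * q + S u)) + k) ≡ (+ 1 +ℤ g) - a q *ℤ g
  P-recur-past-plateau u e plateau = begin
    P (suc x + k)                                                ≡⟨ P-recur x ⟩
    (P (suc p + suc x) +ℤ G (suc x)) - window (suc p) x          ≡⟨ cong₂ (λ P′ w → (P′ +ℤ G (suc x)) - w) P-past-end window-split ⟩
    ((+ 1 +ℤ g) +ℤ G (suc x)) - (window p x +ℤ a q *ℤ g)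
      ≡⟨ cong₂ (λ g′ w → ((+ 1 +ℤ g) +ℤ g′) - (w +ℤ a q *ℤ g)) (ConstantOn⇒G≡0 plateau (suc y) x-in-plateau)
                                                                 (window-zero p x (ConstantOn-shift (2 + y) p window-in-plateau plateau)) ⟩
    ((+ 1 +ℤ g) +ℤ + 0) - (+ 0 +ℤ a q *ℤ g)                     ≡⟨ algebra (+ 1 +ℤ g) (a q *ℤ g) ⟩
    (+ 1 +ℤ g) - a q *ℤ g                                        ∎
    where
    open ≡-Reasoning
    y = suc e * q
    x = suc (y + S u)
    end = suc (suc e) * q + S u
    g = G (suc end)
    past-end : ∀ s → suc p + suc (suc (suc e * (2 + p) + s)) ≡ suc (suc (suc e) * (2 + p) + s)
    past-end s = solve (p ∷ e ∷ s ∷ [])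
    P-past-end : P (suc p + suc x) ≡ + 1 +ℤ g
    P-past-end = trans (cong P (past-end (S u))) (cong (_+ℤ g) (plateau (suc (suc e) * q) ≤-refl))
    last-term : ∀ s → suc (suc e * (2 + p) + s) + (2 + p) ≡ suc (suc (suc e) * (2 + p) + s)
    last-term s = solve (p ∷ e ∷ s ∷ [])
    window-split : window (suc p) x ≡ window p x +ℤ a q *ℤ g
    window-split = trans (sumFrom-snoc 2 p _) (cong (λ n → window p x +ℤ a q *ℤ G n) (last-term (S u)))
    x-in-plateau : suc y < suc (suc e) * q
    x-in-plateau = s≤s (s≤s (m≤n+m y p))
    window-in-plateau : p + (2 + y) ≤ suc (suc e) * q
    window-in-plateau = ≤-reflexive (trans (+-suc p (suc y)) (cong suc (+-suc p y)))
    algebra : ∀ α β → (α +ℤ + 0) - (+ 0 +ℤ β) ≡ α - β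
    algebra = ℤ-Solver.solve-∀

  first-column : ∀ u e → u + suc e ≡ r → G (suc (suc e * q + S u)) ≡ (- (a q - + 1)) ^ u
  first-column zero e refl = begin
    G (suc (r * q + 1))                      ≡⟨ G≡ΔP (r * q + 1) ⟩
    P (suc (r * q + 1)) - P (r * q + 1)      ≡⟨ cong₂ _-_ (trans (cong (λ n → P (suc n)) (+-comm (r * q) 1)) P-k+1) (plateau-initial (r * q) ≤-refl) ⟩
    (+ 1 +ℤ + 1) - + 1                       ≡⟨⟩
    + 1                                      ∎
    where
    open ≡-Reasoning
    P-k+1 : P (1 + k) ≡ + 1 +ℤ + 1
    P-k+1 = trans (P-recur-constant 0 (ConstantOn-⊆ (m≤n⇒m≤n+o (r′ * q) (n≤1+n (suc p))) plateau-initial)) (cong (+ 1 +ℤ_) init₁)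
  first-column (suc u) e u+e≡r = begin
    G (suc (y + S (suc u)))                                ≡⟨ G≡ΔP (y + S (suc u)) ⟩
    P (suc (y + S (suc u))) - P (y + S (suc u))            ≡⟨ cong₂ _-_ (trans (cong (λ n → P (suc n)) (S-suc u y)) (P-recur-past-plateau u e plateau))
                                                                        (next-plateau y ≤-refl) ⟩
    ((+ 1 +ℤ g) - a q *ℤ g) - + 1                          ≡⟨ cong (λ g′ → ((+ 1 +ℤ g′) - a q *ℤ g′) - + 1) (first-column u (suc e) u+e+1≡r) ⟩
    ((+ 1 +ℤ c) - a q *ℤ c) - + 1                          ≡⟨ algebra (a q) c ⟩
    (- (a q - + 1)) ^ suc u                                ∎
    where
    open ≡-Reasoning
    y = suc e * q
    g = G (suc (suc (suc e) * q + S u))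
    c = (- (a q - + 1)) ^ u
    u+e+1≡r : u + suc (suc e) ≡ r
    u+e+1≡r = trans (+-suc u (suc e)) u+e≡r
    plateau : Plateau u (suc (suc e))
    plateau = proj₁ (plateau-diagonal u (suc (suc e)) u+e+1≡r)
    next-plateau : Plateau (suc u) (suc e)
    next-plateau = proj₁ (plateau-diagonal (suc u) (suc e) u+e≡r)
    algebra : ∀ α γ → ((+ 1 +ℤ γ) - α *ℤ γ) - + 1 ≡ (- (α - + 1)) *ℤ γ
    algebra = ℤ-Solver.solve-∀

corollary5p1 : (q : ℕ) → 2 ≤ q → (a : ℕ → ℤ) →
               (∀ i → 2 ≤ i → i ≤ q → + 1 ≤ℤ a i) → + 2 ≤ℤ a q →
               (r : ℕ) → 1 ≤ r → (G : ℕ → ℤ) → IsGSeq q r a G →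
               ∀ t → 1 ≤ t → t ≤ r →
               (G (kOf q r + (t ∸ 1) * cOf q r + 1) ≡ (- (a q - + 1)) ^ (t ∸ 1))
               × (G (kOf q r + (t ∸ 1) * cOf q r + lOf q t) ≡ (- + 1) ^ t)
corollary5p1 (suc (suc p)) (s≤s (s≤s z≤n)) a _ _ (suc r′) _ G isG (suc u) _ (s≤s u≤r′) with m≤n⇒∃[o]m+o≡n u≤r′
... | e , refl = trans (cong G first-index) (first-column u e (+-suc u e))
               , trans (cong G diagonal-index) (proj₂ (plateau-diagonal (suc u) e refl))
  where
  open Rectangle p (u + e) a G isG
  first-index : 1 + suc (u + e) * (2 + p) + u * (2 + (u + e) * (2 + p)) + 1
              ≡ suc (suc e * (2 + p) + suc (u * suc (1 + suc (u + e) * (2 + p))))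
  first-index = solve (p ∷ u ∷ e ∷ [])
  diagonal-index : 1 + suc (u + e) * (2 + p) + u * (2 + (u + e) * (2 + p)) + (2 + u * (2 + p))
                 ≡ suc (suc u * suc (1 + suc (u + e) * (2 + p)))
  diagonal-index = solve (p ∷ u ∷ e ∷ [])
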